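{- Let $J$ be a jellyfish graph with head $H$ and legs isomorphic to the rooted tree $L$. A labeling $\phi$ of $V(J)$ is a distinguishing labeling of $J$ if and only if (i) for every $v\in V(H)$, the restriction $\phi_v$ of $\phi$ to $V(L_v)$ is a distinguishing labeling of the rooted tree $L_v$, and (ii) the projection $\phi_{proj}$ of $\phi$ onto $H$ is a distinguishing labeling of $H$.
   Context: A labeling $\phi:V(G)\to\{1,\dots,c\}$ of a graph $G$ is distinguishing if the only automorphism $\pi$ of $G$ with $\phi(\pi(v))=\phi(v)$ for all $v$ is the identity; for a rooted tree, automorphisms are required to fix the root. A jellyfish graph $J$ is described by a graph $H$ (the head), which contains a Hamiltonian cycle, and a rooted tree $L$: for each vertex $v\in V(H)$ there is a leg $L_v$, a rooted tree with root $v$ isomorphic (as a rooted tree) to $L$; distinct legs are vertex-disjoint, $V(J)$ is the union of the legs, and $E(J)$ consists of the edges of $H$ together with the edges of all legs. For a labeling $\phi$ of $J$, $\phi_v$ denotes its restriction to $V(L_v)$, and the projection $\phi_{proj}$ is a labeling of $V(H)$ such that for $v,w\in V(H)$, $\phi_{proj}(v)=\phi_{proj}(w)$ iff there is an isomorphism of rooted trees from $L_v$ to $L_w$ preserving the labels of $\phi$. -}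

module Defs where

open import Data.Nat using (ℕ; zero; suc; _≤_; _<_)
open import Data.Nat.Properties using (<-irrefl; ≤-reflexive)
open import Data.Fin using (Fin; zero; suc; toℕ; inject₁; fromℕ; _≟_)
open import Data.Bool using (Bool; true; false; _∧_; _∨_)
open import Data.Bool.Properties using (∨-comm; ∧-comm; ∧-zeroʳ)
open import Data.Product using (Σ; _×_; _,_; ∃)
open import Data.Empty using (⊥)
open import Function.Bundles using (_↔_; Inverse; _⇔_)
open import Relation.Nullary using (yes; no)
open import Relation.Nullary.Decidable using (⌊_⌋)
open import Relation.Binary.PropositionalEquality
  using (_≡_; refl; sym; cong; cong₂; trans)

record Graph (V : Set) : Set where
  field
    adj        : V → V → Bool
    adj-sym    : ∀ x y → adj x y ≡ adj y x
    adj-irrefl : ∀ x → adj x x ≡ false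
open Graph public

record Automorphism {V : Set} (G : Graph V) : Set where
  field
    perm      : V ↔ V
    preserves : ∀ x y → adj G (Inverse.to perm x) (Inverse.to perm y) ≡ adj G x y

  map : V → V
  map = Inverse.to perm
open Automorphism public using (perm; preserves)

Distinguishing : {V C : Set} → Graph V → (V → C) → Set
Distinguishing G φ =
  (π : Automorphism G) →
  (∀ v → φ (Automorphism.map π v) ≡ φ v) →
  ∀ v → Automorphism.map π v ≡ v

-- A rooted tree with m+1 vertices has vertex set
-- Fin (suc m), root zero, and every non-root vertex suc i has a parent
-- `parent i` with a smaller index (every rooted tree is isomorphic to
-- one presented this way, e.g. by BFS numbering).

record RootedTree : Set where
  field
    size      : ℕ
    parent    : Fin size → Fin (suc size)
    parent-lt : ∀ i → toℕ (parent i) ≤ toℕ i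
open RootedTree public

TVertex : RootedTree → Set
TVertex T = Fin (suc (size T))

root : (T : RootedTree) → TVertex T
root T = zero

childOf : (T : RootedTree) → TVertex T → TVertex T → Bool
childOf T zero    y = false
childOf T (suc i) y = ⌊ parent T i ≟ y ⌋

private
  childOf-irrefl : (T : RootedTree) → ∀ x → childOf T x x ≡ false
  childOf-irrefl T zero = refl
  childOf-irrefl T (suc i) with parent T i ≟ suc i
  ... | no _  = refl
  ... | yes p = ⊥-elim' (<-irrefl refl (≤-trans' (≤-reflexive (cong toℕ (sym p))) (parent-lt T i)))
    where
      open import Data.Empty using (⊥-elim)
      open import Data.Nat.Properties using (≤-trans)
      ⊥-elim' : ∀ {A : Set} → ⊥ → A
      ⊥-elim' = ⊥-elim
      ≤-trans' = ≤-trans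

treeGraph : (T : RootedTree) → Graph (TVertex T)
treeGraph T = record
  { adj        = λ x y → childOf T x y ∨ childOf T y x
  ; adj-sym    = λ x y → ∨-comm (childOf T x y) (childOf T y x)
  ; adj-irrefl = λ x → trans (cong₂ _∨_ (childOf-irrefl T x) (childOf-irrefl T x)) refl
  }

RootedDistinguishing : {C : Set} → (T : RootedTree) → (TVertex T → C) → Set
RootedDistinguishing T φ =
  (π : Automorphism (treeGraph T)) →
  Automorphism.map π (root T) ≡ root T →
  (∀ v → φ (Automorphism.map π v) ≡ φ v) →
  ∀ v → Automorphism.map π v ≡ v

-- Hamiltonian cycle of a graph on Fin k: k ≥ 3 and an ordering σ of
-- all vertices with σ 0 ~ σ 1 ~ … ~ σ (k-1) ~ σ 0.

HasHamiltonianCycle : {k : ℕ} → Graph (Fin k) → Set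
HasHamiltonianCycle {zero}  H = ⊥
HasHamiltonianCycle {suc n} H =
  2 ≤ n ×
  Σ (Fin (suc n) ↔ Fin (suc n)) λ σ →
    (∀ (i : Fin n) →
       adj H (Inverse.to σ (inject₁ i)) (Inverse.to σ (suc i)) ≡ true) ×
    adj H (Inverse.to σ (fromℕ n)) (Inverse.to σ zero) ≡ true

-- Jellyfish graph with head H (on Fin k) and legs copies of L.
-- Vertex (v , x) is vertex x of the leg L_v; (v , zero) is v ∈ V(H).

JVertex : ℕ → RootedTree → Set
JVertex k L = Fin k × TVertex L

isRoot : {m : ℕ} → Fin (suc m) → Bool
isRoot zero    = true
isRoot (suc _) = false

private
  ≟-sym : {k : ℕ} (v w : Fin k) → ⌊ v ≟ w ⌋ ≡ ⌊ w ≟ v ⌋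
  ≟-sym v w with v ≟ w | w ≟ v
  ... | yes _ | yes _ = refl
  ... | no _  | no _  = refl
  ... | yes p | no q  = ⊥-elim'' (q (sym p))
    where open import Data.Empty using (⊥-elim)
          ⊥-elim'' : ∀ {A : Set} → ⊥ → A
          ⊥-elim'' = ⊥-elim
  ... | no q  | yes p = ⊥-elim'' (q (sym p))
    where open import Data.Empty using (⊥-elim)
          ⊥-elim'' : ∀ {A : Set} → ⊥ → A
          ⊥-elim'' = ⊥-elim

jellyAdj : {k : ℕ} → Graph (Fin k) → (L : RootedTree) →
           JVertex k L → JVertex k L → Bool
jellyAdj H L (v , x) (w , y) =
  (isRoot x ∧ (isRoot y ∧ adj H v w)) ∨ (⌊ v ≟ w ⌋ ∧ adj (treeGraph L) x y)

private
  jellyAdj-sym : {k : ℕ} (H : Graph (Fin k)) (L : RootedTree) →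
                 ∀ p q → jellyAdj H L p q ≡ jellyAdj H L q p
  jellyAdj-sym H L (v , x) (w , y)
    rewrite adj-sym H v w | ≟-sym v w | adj-sym (treeGraph L) x y
    with isRoot x | isRoot y
  ... | true  | true  = refl
  ... | true  | false = refl
  ... | false | true  = refl
  ... | false | false = refl

  jellyAdj-irrefl : {k : ℕ} (H : Graph (Fin k)) (L : RootedTree) →
                    ∀ p → jellyAdj H L p p ≡ false
  jellyAdj-irrefl H L (v , x)
    rewrite adj-irrefl H v | adj-irrefl (treeGraph L) x
          | ∧-zeroʳ (isRoot x) | ∧-zeroʳ (isRoot x) | ∧-zeroʳ ⌊ v ≟ v ⌋ = refl

jellyfish : {k : ℕ} → Graph (Fin k) → (L : RootedTree) → Graph (JVertex k L)
jellyfish H L = record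
  { adj        = jellyAdj H L
  ; adj-sym    = jellyAdj-sym H L
  ; adj-irrefl = jellyAdj-irrefl H L
  }

restrict : {k : ℕ} {L : RootedTree} {C : Set} →
           (JVertex k L → C) → Fin k → TVertex L → C
restrict φ v x = φ (v , x)

-- Isomorphism of rooted trees L_v → L_w preserving the labels of φ.
-- Both legs are copies of L, so such an isomorphism is a root-fixing
-- automorphism ψ of L with φ(w, ψ x) = φ(v, x).
LabelledLegIso : {k : ℕ} {L : RootedTree} {C : Set} →
                 (JVertex k L → C) → Fin k → Fin k → Set
LabelledLegIso {L = L} φ v w =
  Σ (Automorphism (treeGraph L)) λ ψ →
    (Automorphism.map ψ (root L) ≡ root L) ×
    (∀ x → φ (w , Automorphism.map ψ x) ≡ φ (v , x))

IsProjection : {k : ℕ} {L : RootedTree} {C D : Set} →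
               (JVertex k L → C) → (Fin k → D) → Set
IsProjection {k} {L} φ ρ = ∀ (v w : Fin k) → (ρ v ≡ ρ w) ⇔ LabelledLegIso {L = L} φ v w

-- An automorphism of J that sends every head vertex to a head vertex is the
-- same thing as an automorphism h of H together with root-fixing
-- isomorphisms L_v → L_{h v}; it preserves φ iff h preserves the projection
-- and every leg isomorphism preserves the labels.  The Hamiltonian cycle is only
-- needed to show that the head really is invariant: take the head vertex whose
-- image is deepest in its leg.  If that image is not a root, the images of its
-- two distinct cycle neighbours are neighbours of it that are not deeper, so
-- both are its parent, contradicting injectivity.

module Submission where

open import Defs
open import Data.Nat using (ℕ; zero; suc; _+_; _≤_; z≤n; s≤s)
import Data.Nat.Properties as ℕ
open import Data.Fin using (Fin; zero; suc; toℕ; inject₁; fromℕ; _≟_)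
open import Data.Fin.Properties using (toℕ-inject₁; toℕ-injective; 0≢1+n)
open import Data.Bool using (true; _∧_; _∨_)
open import Data.Bool.Properties using (∧-zeroʳ; ∨-identityʳ)
open import Data.Product using (Σ; _×_; _,_; proj₁; proj₂)
open import Data.Sum using (_⊎_; inj₁; inj₂)
open import Data.Empty using (⊥-elim)
open import Function.Base using (_∘_)
open import Function.Bundles using (_↔_; Inverse; Injection; _⇔_; mk⇔; mk↔ₛ′; Equivalence)
open import Function.Properties.Inverse using (Inverse⇒Injection)
open import Relation.Nullary using (yes; no; ¬_)
open import Relation.Nullary.Decidable using (⌊_⌋)
open import Relation.Binary.PropositionalEquality
open Automorphism using (map)

module _ {V : Set} {G : Graph V} where

  map⁻¹ : Automorphism G → V → V
  map⁻¹ π = Inverse.from (perm π)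

  map-map⁻¹ : (π : Automorphism G) → ∀ y → map π (map⁻¹ π y) ≡ y
  map-map⁻¹ π = Inverse.strictlyInverseˡ (perm π)

  map⁻¹-map : (π : Automorphism G) → ∀ x → map⁻¹ π (map π x) ≡ x
  map⁻¹-map π = Inverse.strictlyInverseʳ (perm π)

  map-injective : (π : Automorphism G) → ∀ {x y} → map π x ≡ map π y → x ≡ y
  map-injective π = Injection.injective (Inverse⇒Injection (perm π))

  inverseAut : Automorphism G → Automorphism G
  inverseAut π = record
    { perm      = mk↔ₛ′ (map⁻¹ π) (map π) (map⁻¹-map π) (map-map⁻¹ π)
    ; preserves = λ x y → trans (sym (preserves π (map⁻¹ π x) (map⁻¹ π y)))
                                (cong₂ (adj G) (map-map⁻¹ π x) (map-map⁻¹ π y))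
    }

  identityAut : Automorphism G
  identityAut = record
    { perm      = mk↔ₛ′ (λ x → x) (λ x → x) (λ _ → refl) (λ _ → refl)
    ; preserves = λ _ _ → refl
    }

≟-refl : ∀ {k} (a : Fin k) → ⌊ a ≟ a ⌋ ≡ true
≟-refl a = cong ⌊_⌋ (≡-≟-identity _≟_ refl)

argmax : ∀ {n} (f : Fin n → ℕ) → Fin n → Σ (Fin n) λ j → ∀ i → f i ≤ f j
argmax {suc zero}    f _ = zero , λ { zero → ℕ.≤-refl }
argmax {suc (suc n)} f _ with argmax (f ∘ suc) zero
... | j , max with f zero ℕ.≤? f (suc j)
...   | yes f0≤ = suc j , λ { zero → f0≤ ; (suc i) → max i }
...   | no  f0≰ = zero  , λ { zero → ℕ.≤-refl
                            ; (suc i) → ℕ.≤-trans (max i) (ℕ.≰⇒≥ f0≰) }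

fromℕ-or-inject₁ : ∀ {n} (j : Fin (suc n)) → j ≡ fromℕ n ⊎ Σ (Fin n) (λ i → j ≡ inject₁ i)
fromℕ-or-inject₁ {zero}  zero    = inj₁ refl
fromℕ-or-inject₁ {suc n} zero    = inj₂ (zero , refl)
fromℕ-or-inject₁ {suc n} (suc j) with fromℕ-or-inject₁ j
... | inj₁ j≡last     = inj₁ (cong suc j≡last)
... | inj₂ (i , j≡i)  = inj₂ (suc i , cong suc j≡i)

FixesRoot : {T : RootedTree} → Automorphism (treeGraph T) → Set
FixesRoot {T} ψ = map ψ (root T) ≡ root T

module _ (T : RootedTree) where

  tree-ind : (P : TVertex T → Set) → P zero → (∀ i → P (parent T i) → P (suc i)) →
             ∀ x → P x
  tree-ind P base step x = go (toℕ x) x ℕ.≤-refl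
    where
      go : ∀ b x → toℕ x ≤ b → P x
      go _       zero    _         = base
      go (suc b) (suc i) (s≤s i≤b) = step i (go b (parent T i) (ℕ.≤-trans (parent-lt T i) i≤b))

  child-adj-parent : ∀ i → adj (treeGraph T) (suc i) (parent T i) ≡ true
  child-adj-parent i rewrite ≟-refl (parent T i) = refl

  -- Children have larger indices than their parent.
  adj-below⇒parent : ∀ i y → adj (treeGraph T) y (suc i) ≡ true → toℕ y ≤ toℕ (suc i) →
                     y ≡ parent T i
  adj-below⇒parent i zero e _ with parent T i ≟ zero
  ... | yes p = sym p
  adj-below⇒parent i (suc j) e y≤ with parent T j ≟ suc i
  ... | yes q = ⊥-elim (ℕ.<-irrefl refl
                  (ℕ.≤-trans y≤ (subst (_≤ toℕ j) (cong toℕ q) (parent-lt T j))))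
  ... | no _ with parent T i ≟ suc j
  ...   | yes p = sym p

  isRoot-map : (ψ : Automorphism (treeGraph T)) → FixesRoot ψ → ∀ x → isRoot (map ψ x) ≡ isRoot x
  isRoot-map ψ ψ-root zero    = cong isRoot ψ-root
  isRoot-map ψ ψ-root (suc i) with map ψ (suc i) in eq
  ... | zero  = ⊥-elim (0≢1+n (map-injective ψ (trans ψ-root (sym eq))))
  ... | suc _ = refl

record DistinctNeighbours {V : Set} (G : Graph V) (v : V) : Set where
  field
    left right : V
    left-adj   : adj G left v ≡ true
    right-adj  : adj G right v ≡ true
    left≢right : ¬ left ≡ right

cycle-neighbours : ∀ m (H : Graph (Fin (3 + m))) (σ : Fin (3 + m) ↔ Fin (3 + m)) →
  (∀ i → adj H (Inverse.to σ (inject₁ i)) (Inverse.to σ (suc i)) ≡ true) →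
  adj H (Inverse.to σ (fromℕ (2 + m))) (Inverse.to σ zero) ≡ true →
  ∀ j → DistinctNeighbours H (Inverse.to σ j)
cycle-neighbours m H σ next wrap j = neighbours (positions j)
  where
    s : Fin (3 + m) → Fin (3 + m)
    s = Inverse.to σ
    Positions : Fin (3 + m) → Set
    Positions j = Σ (Fin (3 + m)) λ p → Σ (Fin (3 + m)) λ q →
                  adj H (s p) (s j) ≡ true × adj H (s q) (s j) ≡ true × ¬ p ≡ q
    next⁻ : ∀ i → adj H (s (suc i)) (s (inject₁ i)) ≡ true
    next⁻ i = trans (adj-sym H _ _) (next i)
    positions : ∀ j → Positions j
    positions zero = fromℕ (2 + m) , suc zero , wrap , next⁻ zero , λ ()
    positions (suc i) with fromℕ-or-inject₁ (suc i)
    ... | inj₁ refl = inject₁ i , zero , next i , trans (adj-sym H _ _) wrap , λ ()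
    ... | inj₂ (i′ , i+1≡i′) =
      inject₁ i , suc i′ , next i , trans (cong (adj H (s (suc i′)) ∘ s) i+1≡i′) (next⁻ i′) ,
      λ i≡i′+1 → ℕ.<-asym
        (ℕ.≤-reflexive (sym (trans (sym (toℕ-inject₁ i)) (cong toℕ i≡i′+1))))
        (ℕ.≤-reflexive (trans (cong toℕ i+1≡i′) (toℕ-inject₁ i′)))
    neighbours : Positions j → DistinctNeighbours H (s j)
    neighbours (p , q , p-adj , q-adj , p≢q) = record
      { left = s p ; right = s q ; left-adj = p-adj ; right-adj = q-adj
      ; left≢right = p≢q ∘ Injection.injective (Inverse⇒Injection σ) }

hamiltonian⇒distinctNeighbours : ∀ {k} (H : Graph (Fin k)) → HasHamiltonianCycle H →
                                 ∀ v → DistinctNeighbours H v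
hamiltonian⇒distinctNeighbours {suc (suc (suc m))} H (s≤s (s≤s z≤n) , σ , next , wrap) v =
  subst (DistinctNeighbours H) (Inverse.strictlyInverseˡ σ v)
        (cycle-neighbours m H σ next wrap (Inverse.from σ v))

module _ {k : ℕ} (H : Graph (Fin k)) (L : RootedTree) where

  jellyAdj-head : ∀ v w → jellyAdj H L (v , zero) (w , zero) ≡ adj H v w
  jellyAdj-head v w = trans (cong (adj H v w ∨_) (∧-zeroʳ ⌊ v ≟ w ⌋)) (∨-identityʳ _)

  jellyAdj-leg : ∀ v x y → jellyAdj H L (v , x) (v , y) ≡ adj (treeGraph L) x y
  jellyAdj-leg v x y
    rewrite adj-irrefl H v | ∧-zeroʳ (isRoot y) | ∧-zeroʳ (isRoot x) | ≟-refl v = refl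

  jellyAdj-nonHead : ∀ v w i y → jellyAdj H L (w , y) (v , suc i) ≡ true →
                     w ≡ v × adj (treeGraph L) y (suc i) ≡ true
  jellyAdj-nonHead v w i zero    e with w ≟ v
  ... | yes w≡v = w≡v , e
  jellyAdj-nonHead v w i (suc j) e with w ≟ v
  ... | yes w≡v = w≡v , e

  HeadPreserving : Automorphism (jellyfish H L) → Set
  HeadPreserving π = ∀ v → proj₂ (map π (v , zero)) ≡ zero

  head-preserved : (∀ v → DistinctNeighbours H v) →
                   (π : Automorphism (jellyfish H L)) → HeadPreserving π
  head-preserved neighbours π v =
    toℕ-injective (ℕ.n≤0⇒n≡0 (subst (λ z → depth v ≤ toℕ z) top-is-head (deepest v)))
    where
      g : Fin k → JVertex k L
      g j = map π (j , zero)
      depth : Fin k → ℕ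
      depth j = toℕ (proj₂ (g j))
      top : Fin k
      top = proj₁ (argmax depth v)
      deepest : ∀ j → depth j ≤ depth top
      deepest = proj₂ (argmax depth v)

      lands-on-parent : ∀ {a i} → g top ≡ (a , suc i) →
                        ∀ r → adj H r top ≡ true → g r ≡ (a , parent L i)
      lands-on-parent {a} {i} eq r r-adj = cong₂ _,_ (proj₁ same-leg)
        (adj-below⇒parent L i _ (proj₂ same-leg) (subst (λ z → depth r ≤ toℕ (proj₂ z)) eq (deepest r)))
        where
          same-leg : proj₁ (g r) ≡ a × adj (treeGraph L) (proj₂ (g r)) (suc i) ≡ true
          same-leg = jellyAdj-nonHead a (proj₁ (g r)) i (proj₂ (g r))
            (subst (λ z → jellyAdj H L (g r) z ≡ true) eq
              (trans (preserves π (r , zero) (top , zero)) (trans (jellyAdj-head r top) r-adj)))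

      top-is-head : proj₂ (g top) ≡ zero
      top-is-head with g top in eq
      ... | (_ , zero)  = refl
      ... | (a , suc i) = ⊥-elim (left≢right (cong proj₁ (map-injective π
                            (trans (lands-on-parent eq left left-adj)
                                   (sym (lands-on-parent eq right right-adj))))))
        where open DistinctNeighbours (neighbours top)

  lift : (h : Automorphism H) (ψ : Fin k → Automorphism (treeGraph L)) →
         (∀ v → FixesRoot (ψ v)) → Automorphism (jellyfish H L)
  lift h ψ ψ-root = record
    { perm      = mk↔ₛ′ to from to-from from-to
    ; preserves = to-preserves
    }
    where
      to : JVertex k L → JVertex k L
      to (v , x) = map h v , map (ψ v) x
      from : JVertex k L → JVertex k L
      from (w , y) = map⁻¹ h w , map⁻¹ (ψ (map⁻¹ h w)) y
      to-from : ∀ p → to (from p) ≡ p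
      to-from (w , y) = cong₂ _,_ (map-map⁻¹ h w) (map-map⁻¹ (ψ (map⁻¹ h w)) y)
      from-leg : ∀ v x u → u ≡ v → (u , map⁻¹ (ψ u) (map (ψ v) x)) ≡ (v , x)
      from-leg v x .v refl = cong (v ,_) (map⁻¹-map (ψ v) x)
      from-to : ∀ p → from (to p) ≡ p
      from-to (v , x) = from-leg v x (map⁻¹ h (map h v)) (map⁻¹-map h v)
      to-preserves : ∀ p q → jellyAdj H L (to p) (to q) ≡ jellyAdj H L p q
      to-preserves (v , x) (w , y)
        rewrite isRoot-map L (ψ v) (ψ-root v) x | isRoot-map L (ψ w) (ψ-root w) y | preserves h v w
        with v ≟ w | map h v ≟ map h w
      ... | yes refl | yes _     = cong (isRoot x ∧ (isRoot y ∧ adj H v v) ∨_) (preserves (ψ v) x y)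
      ... | yes refl | no hv≢hv  = ⊥-elim (hv≢hv refl)
      ... | no v≢w   | yes hv≡hw = ⊥-elim (v≢w (map-injective h hv≡hw))
      ... | no _     | no _      = refl

  record IsLift (π : Automorphism (jellyfish H L)) : Set where
    field
      head     : Automorphism H
      leg      : Fin k → Automorphism (treeGraph L)
      leg-root : ∀ v → FixesRoot (leg v)
      map-lift : ∀ v x → map π (v , x) ≡ (map head v , map (leg v) x)

  leg-preserved : (ρ : Automorphism (jellyfish H L)) → HeadPreserving (inverseAut ρ) →
                  ∀ v x → proj₁ (map ρ (v , x)) ≡ proj₁ (map ρ (v , zero))
  leg-preserved ρ ρ⁻¹-head v =
    tree-ind L (λ x → proj₁ (map ρ (v , x)) ≡ proj₁ (map ρ (v , zero))) refl step
    where
      step : ∀ i → proj₁ (map ρ (v , parent L i)) ≡ proj₁ (map ρ (v , zero)) →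
             proj₁ (map ρ (v , suc i)) ≡ proj₁ (map ρ (v , zero))
      step i ih with map ρ (v , suc i) in eq
      ... | (u , zero)  = ⊥-elim (0≢1+n (trans (sym (ρ⁻¹-head u))
                            (trans (cong (proj₂ ∘ map⁻¹ ρ) (sym eq)) (cong proj₂ (map⁻¹-map ρ _)))))
      ... | (u , suc j) = trans (sym (proj₁ (jellyAdj-nonHead u _ j _ parent-adj))) ih
        where
          parent-adj : jellyAdj H L (map ρ (v , parent L i)) (u , suc j) ≡ true
          parent-adj = subst (λ z → jellyAdj H L (map ρ (v , parent L i)) z ≡ true) eq
            (trans (preserves ρ (v , parent L i) (v , suc i))
              (trans (jellyAdj-leg v (parent L i) (suc i))
                (trans (adj-sym (treeGraph L) (parent L i) (suc i)) (child-adj-parent L i))))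

  headPreserving⇒isLift : (π : Automorphism (jellyfish H L)) →
                          HeadPreserving π → HeadPreserving (inverseAut π) → IsLift π
  headPreserving⇒isLift π π-head π⁻¹-head = record
    { head     = record { perm = mk↔ₛ′ h h⁻¹ h-h⁻¹ h⁻¹-h ; preserves = h-preserves }
    ; leg      = leg
    ; leg-root = π-head
    ; map-lift = π-leg
    }
    where
      h h⁻¹ : Fin k → Fin k
      h v   = proj₁ (map π (v , zero))
      h⁻¹ w = proj₁ (map⁻¹ π (w , zero))
      ψ ψ⁻¹ : Fin k → TVertex L → TVertex L
      ψ v x   = proj₂ (map π (v , x))
      ψ⁻¹ v y = proj₂ (map⁻¹ π (h v , y))

      π-leg : ∀ v x → map π (v , x) ≡ (h v , ψ v x)
      π-leg v x = cong (_, ψ v x) (leg-preserved π π⁻¹-head v x)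
      π-root : ∀ v → map π (v , zero) ≡ (h v , zero)
      π-root v = cong (h v ,_) (π-head v)
      π⁻¹-root : ∀ w → map⁻¹ π (w , zero) ≡ (h⁻¹ w , zero)
      π⁻¹-root w = cong (h⁻¹ w ,_) (π⁻¹-head w)

      h-h⁻¹ : ∀ w → h (h⁻¹ w) ≡ w
      h-h⁻¹ w = trans (cong (proj₁ ∘ map π) (sym (π⁻¹-root w))) (cong proj₁ (map-map⁻¹ π (w , zero)))
      h⁻¹-h : ∀ v → h⁻¹ (h v) ≡ v
      h⁻¹-h v = trans (cong (proj₁ ∘ map⁻¹ π) (sym (π-root v))) (cong proj₁ (map⁻¹-map π (v , zero)))

      π⁻¹-leg : ∀ v y → map⁻¹ π (h v , y) ≡ (v , ψ⁻¹ v y)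
      π⁻¹-leg v y = cong (_, ψ⁻¹ v y) (trans (leg-preserved (inverseAut π) π-head (h v) y) (h⁻¹-h v))

      h-preserves : ∀ v w → adj H (h v) (h w) ≡ adj H v w
      h-preserves v w = begin
        adj H (h v) (h w)                          ≡⟨ jellyAdj-head (h v) (h w) ⟨
        jellyAdj H L (h v , zero) (h w , zero)     ≡⟨ cong₂ (jellyAdj H L) (π-root v) (π-root w) ⟨
        jellyAdj H L (map π (v , zero)) (map π (w , zero)) ≡⟨ preserves π (v , zero) (w , zero) ⟩
        jellyAdj H L (v , zero) (w , zero)         ≡⟨ jellyAdj-head v w ⟩
        adj H v w                                  ∎
        where open ≡-Reasoning

      ψ-preserves : ∀ v x y → adj (treeGraph L) (ψ v x) (ψ v y) ≡ adj (treeGraph L) x y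
      ψ-preserves v x y = begin
        adj (treeGraph L) (ψ v x) (ψ v y)              ≡⟨ jellyAdj-leg (h v) (ψ v x) (ψ v y) ⟨
        jellyAdj H L (h v , ψ v x) (h v , ψ v y)       ≡⟨ cong₂ (jellyAdj H L) (π-leg v x) (π-leg v y) ⟨
        jellyAdj H L (map π (v , x)) (map π (v , y))   ≡⟨ preserves π (v , x) (v , y) ⟩
        jellyAdj H L (v , x) (v , y)                   ≡⟨ jellyAdj-leg v x y ⟩
        adj (treeGraph L) x y                          ∎
        where open ≡-Reasoning

      leg : Fin k → Automorphism (treeGraph L)
      leg v = record
        { perm      = mk↔ₛ′ (ψ v) (ψ⁻¹ v)
            (λ y → cong proj₂ (trans (cong (map π) (sym (π⁻¹-leg v y))) (map-map⁻¹ π (h v , y))))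
            (λ x → cong proj₂ (trans (cong (map⁻¹ π) (sym (π-leg v x))) (map⁻¹-map π (v , x))))
        ; preserves = ψ-preserves v
        }

  hamiltonian⇒isLift : HasHamiltonianCycle H → (π : Automorphism (jellyfish H L)) → IsLift π
  hamiltonian⇒isLift hc π =
    headPreserving⇒isLift π (head-preserved neighbours π) (head-preserved neighbours (inverseAut π))
    where
      neighbours : ∀ v → DistinctNeighbours H v
      neighbours = hamiltonian⇒distinctNeighbours H hc

  onLeg : Fin k → Automorphism (treeGraph L) → Fin k → Automorphism (treeGraph L)
  onLeg v χ w with w ≟ v
  ... | yes _ = χ
  ... | no _  = identityAut

  onLeg-root : ∀ v χ → FixesRoot χ → ∀ w → FixesRoot (onLeg v χ w)
  onLeg-root v χ χ-root w with w ≟ v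
  ... | yes _ = χ-root
  ... | no _  = refl

  onLeg-self : ∀ v χ x → map (onLeg v χ v) x ≡ map χ x
  onLeg-self v χ x with v ≟ v
  ... | yes _  = refl
  ... | no v≢v = ⊥-elim (v≢v refl)

module _ {k : ℕ} (H : Graph (Fin k)) (L : RootedTree) {C : Set} (φ : JVertex k L → C) where

  distinguishing⇒legs : Distinguishing (jellyfish H L) φ →
                        ∀ v → RootedDistinguishing L (restrict {L = L} φ v)
  distinguishing⇒legs J-dist v χ χ-root χ-φ x =
    trans (sym (onLeg-self H L v χ x)) (cong proj₂ (J-dist χ̂ χ̂-φ (v , x)))
    where
      χ̂ : Automorphism (jellyfish H L)
      χ̂ = lift H L identityAut (onLeg H L v χ) (onLeg-root H L v χ χ-root)
      χ̂-φ : ∀ p → φ (map χ̂ p) ≡ φ p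
      χ̂-φ (w , y) with w ≟ v
      ... | yes refl = χ-φ y
      ... | no _     = refl

  module _ {D : Set} (φproj : Fin k → D) (projection : IsProjection {L = L} φ φproj) where

    distinguishing⇒head : Distinguishing (jellyfish H L) φ → Distinguishing H φproj
    distinguishing⇒head J-dist π π-φproj v = cong proj₁ (J-dist π̂ π̂-φ (v , zero))
      where
        legIso : ∀ v → LabelledLegIso {L = L} φ v (map π v)
        legIso v = Equivalence.to (projection v (map π v)) (sym (π-φproj v))
        π̂ : Automorphism (jellyfish H L)
        π̂ = lift H L π (proj₁ ∘ legIso) (proj₁ ∘ proj₂ ∘ legIso)
        π̂-φ : ∀ p → φ (map π̂ p) ≡ φ p
        π̂-φ (w , y) = proj₂ (proj₂ (legIso w)) y

    legs×head⇒distinguishing : HasHamiltonianCycle H →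
                               (∀ v → RootedDistinguishing L (restrict {L = L} φ v)) →
                               Distinguishing H φproj → Distinguishing (jellyfish H L) φ
    legs×head⇒distinguishing hc legs-dist head-dist π π-φ (v , x) =
      trans (map-lift v x) (cong₂ _,_ (head-id v) (legs-dist v (leg v) (leg-root v) leg-φ x))
      where
        open IsLift (hamiltonian⇒isLift H L hc π)
        labelled : ∀ v x → φ (map head v , map (leg v) x) ≡ φ (v , x)
        labelled v x = trans (cong φ (sym (map-lift v x))) (π-φ (v , x))
        head-id : ∀ v → map head v ≡ v
        head-id = head-dist head λ v →
          sym (Equivalence.from (projection v (map head v)) (leg v , leg-root v , labelled v))
        leg-φ : ∀ y → φ (v , map (leg v) y) ≡ φ (v , y)
        leg-φ y = subst (λ u → φ (u , map (leg v) y) ≡ φ (v , y)) (head-id v) (labelled v y)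

lemma3 : (k : ℕ) (H : Graph (Fin k)) → HasHamiltonianCycle H →
         (L : RootedTree) (c : ℕ) (φ : JVertex k L → Fin c) →
         (D : Set) (φproj : Fin k → D) → IsProjection {L = L} φ φproj →
         Distinguishing (jellyfish H L) φ ⇔
           ((∀ (v : Fin k) → RootedDistinguishing L (restrict {L = L} φ v)) ×
            Distinguishing H φproj)
lemma3 k H hc L c φ D φproj projection = mk⇔
  (λ J-dist → distinguishing⇒legs H L φ J-dist , distinguishing⇒head H L φ φproj projection J-dist)
  (λ (legs-dist , head-dist) →
     legs×head⇒distinguishing H L φ φproj projection hc legs-dist head-dist)
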